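{- Let $m\ge 2$ be an integer and let $\varepsilon>0$ be a fixed (arbitrarily small) real number. Let $p=\prod_{r=1}^{N} s_{u_r,v_r}$ be a monomial (a finite product, repetitions allowed) in the integers $s_{u,v}$ with $1\le v\le u$, and let $\ell\ge -1$ be an integer. If $v(p)>\ell$, then $p$ is divisible by $\dfrac{m^{\ell+1}}{c_{\ell+2}}$, where $c_t=1$ if $m$ is odd and $c_t=2^{t-1}$ if $m$ is even.
   Context: The integers $s_{j,i}$ ($0\le i\le j$) are defined by the polynomial identity in $k$ \[ \binom{km+1}{j}=\sum_{i=0}^{j}s_{j,i}\binom{k}{i}, \] so $s_{j,i}$ is independent of $k$. An evaluation $v$ on such monomials is defined by $v(s_{j,j})=j$, $v(s_{j,j-1})=j-1-\varepsilon$, $v(s_{j,i})=0$ for $1\le i<j-1$, extended additively: $v(s_{j,i}s_{j',i'}\cdots)=v(s_{j,i})+v(s_{j',i'})+\cdots$. For $m$ even, $m^{\ell+1}/2^{\ell+1}=(m/2)^{\ell+1}$ is an integer.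
   Formalization: The parameter ε in the evaluation v ranges over the positive rationals rather than the positive reals. -}

module Defs where

open import Data.Nat as ℕ using (ℕ; zero; suc; _^_; _∸_; NonZero)
open import Data.Nat.Properties using (m^n≢0)
open import Data.Nat.Divisibility using (_∣?_)
open import Data.Nat.Combinatorics using (_C_)
open import Data.Integer as ℤ using (ℤ; +_)
open import Data.Rational as ℚ using (ℚ; _/_)
open import Data.List using (List; []; _∷_)
open import Data.Product using (_×_; _,_)
open import Relation.Nullary using (yes; no)

sumTo : ℕ → (ℕ → ℤ) → ℤ
sumTo zero    f = f 0
sumTo (suc j) f = sumTo j f ℤ.+ f (suc j)

-- The defining identity of the integers s_{j,i}:
--   C(km+1, j) = Σ_{i=0}^{j} s_{j,i} C(k,i)   for all k (and all j).
IsSCoeffs : ℕ → (ℕ → ℕ → ℤ) → Set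
IsSCoeffs m s = ∀ (j k : ℕ) →
  + ((k ℕ.* m ℕ.+ 1) C j) ≡ sumTo j (λ i → s j i ℤ.* + (k C i))
  where open import Relation.Binary.PropositionalEquality using (_≡_)

Monomial : Set
Monomial = List (ℕ × ℕ)

evalMon : (ℕ → ℕ → ℤ) → Monomial → ℤ
evalMon s []             = + 1
evalMon s ((u , v) ∷ ps) = s u v ℤ.* evalMon s ps

data WellIndexed : Monomial → Set where
  []  : WellIndexed []
  _∷_ : ∀ {u v ps} → (1 ℕ.≤ v) × (v ℕ.≤ u) → WellIndexed ps → WellIndexed ((u , v) ∷ ps)

ℕtoℚ : ℕ → ℚ
ℕtoℚ n = + n / 1

vFactor : ℚ → ℕ → ℕ → ℚ
vFactor ε j i with i ℕ.≟ j
... | yes _ = ℕtoℚ j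
... | no _ with suc i ℕ.≟ j
...   | yes _ = ℕtoℚ i ℚ.- ε
...   | no _  = ℚ.0ℚ

vMon : ℚ → Monomial → ℚ
vMon ε []             = ℚ.0ℚ
vMon ε ((u , v) ∷ ps) = vFactor ε u v ℚ.+ vMon ε ps

c : ℕ → ℕ → ℕ
c m t with 2 ∣? m
... | yes _ = 2 ^ (t ∸ 1)
... | no _  = 1

c-nonZero : ∀ m t → NonZero (c m t)
c-nonZero m t with 2 ∣? m
... | yes _ = m^n≢0 2 (t ∸ 1)
... | no _  = _

-- m^(ℓ+1) / c_(ℓ+2), where e = ℓ + 1 (exact natural-number division)
divisor : ℕ → ℕ → ℕ
divisor m e = ℕ._/_ (m ^ e) (c m (suc e)) {{c-nonZero m (suc e)}}

module Submission where

-- Write F_j(k) = C(km+1, j).  The defining identity says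
-- that s_{j,0}, …, s_{j,j} are the coefficients of F_j in the binomial basis
-- C(k,i), so by Newton's forward-difference formula s_{j,i} = (Δⁱ F_j)(0) =: T_{j,i}.
-- Vandermonde's identity gives Δ F_{j+1} = Σ_{b≤j} C(m, j+1−b) F_b, hence the
-- recurrence T_{j+1,i+1} = Σ_{b≤j} C(m, j+1−b) T_{b,i}, and T_{b,i} = 0 for b < i.
-- From it: s_{j,j} = m^j and s_{j+1,j} = C(m,2)m^{j−1} + m s_{j,j−1}, so every
-- d dividing both m and C(m,2) satisfies d^j ∣ s_{j,j} and d^j ∣ s_{j+1,j}.
-- Hence d^{w(p)} ∣ p, where w is the integer weight (j on s_{j,j}, j−1 on
-- s_{j,j−1}, 0 otherwise).  The divisor m^{ℓ+1}/c_{ℓ+2} equals base^{ℓ+1}, where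
-- base = m/2 for even m and base = m for odd m is such a d.  Finally
-- v(p) ≤ w(p) because ε ≥ 0, so ℓ < v(p) gives ℓ+1 ≤ w(p), and the theorem follows.

open import Defs
open import Data.Nat as ℕ using (ℕ; zero; suc; z≤n; s≤s; _∸_; _^_)
open import Data.Integer as ℤ using (ℤ; +_; -[1+_]; ∣_∣)
open import Data.Integer.Divisibility as ℤD using ()
open import Data.Rational as ℚ using (ℚ; _/_)
open import Data.Rational.Unnormalised as ℚᵘ using (mkℚᵘ; *≡*)
import Data.Nat.Properties as ℕP
import Data.Integer.Properties as ℤP
import Data.Rational.Properties as ℚP
import Data.Rational.Unnormalised.Properties as ℚᵘP
import Data.Integer.Divisibility.Signed as ℤS
open import Data.Nat.Divisibility as ℕD using (_∣?_)
open import Data.Nat.DivMod using (m*n/n≡m; n/1≡n)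
open import Data.Nat.Primality using (euclidsLemma; prime[2])
open import Data.Nat.Combinatorics using (_C_; nC1≡n; nCk+nC[k+1]≡[n+1]C[k+1])
open import Data.Integer.Tactic.RingSolver using (solve-∀)
import Data.Nat.Tactic.RingSolver as ℕRing
open import Relation.Binary.PropositionalEquality
open import Relation.Nullary using (yes; no)
open import Data.Empty using (⊥-elim)
open import Data.Sum using (inj₁; inj₂)
open import Data.Product using (_,_)
open import Data.List using ([]; _∷_)

sumTo-cong : ∀ n (f g : ℕ → ℤ) → (∀ i → f i ≡ g i) → sumTo n f ≡ sumTo n g
sumTo-cong zero    f g f≡g = f≡g 0
sumTo-cong (suc n) f g f≡g = cong₂ ℤ._+_ (sumTo-cong n f g f≡g) (f≡g (suc n))

sumTo-+ : ∀ n (f g : ℕ → ℤ) → sumTo n (λ i → f i ℤ.+ g i) ≡ sumTo n f ℤ.+ sumTo n g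
sumTo-+ zero    f g = refl
sumTo-+ (suc n) f g =
  trans (cong (ℤ._+ (f (suc n) ℤ.+ g (suc n))) (sumTo-+ n f g))
        (interchange (sumTo n f) (sumTo n g) (f (suc n)) (g (suc n)))
  where
  interchange : ∀ a b c d → (a ℤ.+ b) ℤ.+ (c ℤ.+ d) ≡ (a ℤ.+ c) ℤ.+ (b ℤ.+ d)
  interchange = solve-∀

sumTo-shift : ∀ n (f : ℕ → ℤ) → sumTo (suc n) f ≡ f 0 ℤ.+ sumTo n (λ i → f (suc i))
sumTo-shift zero    f = refl
sumTo-shift (suc n) f =
  trans (cong (ℤ._+ f (suc (suc n))) (sumTo-shift n f))
        (ℤP.+-assoc (f 0) (sumTo n (λ i → f (suc i))) (f (suc (suc n))))

sumTo-head : ∀ n (f : ℕ → ℤ) → (∀ i → f (suc i) ≡ ℤ.0ℤ) → sumTo n f ≡ f 0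
sumTo-head zero    f _  = refl
sumTo-head (suc n) f f0 =
  trans (cong₂ ℤ._+_ (sumTo-head n f f0) (f0 n)) (ℤP.+-identityʳ (f 0))

sumTo-last : ∀ n (f : ℕ → ℤ) → (∀ b → b ℕ.< n → f b ≡ ℤ.0ℤ) → sumTo n f ≡ f n
sumTo-last zero    f _  = refl
sumTo-last (suc n) f f0 =
  trans (cong (ℤ._+ f (suc n))
               (trans (sumTo-last n f (λ b b<n → f0 b (ℕP.m<n⇒m<1+n b<n))) (f0 n ℕP.≤-refl)))
        (ℤP.+-identityˡ (f (suc n)))

pascal : ∀ n k → + (suc n C suc k) ≡ + (n C suc k) ℤ.+ + (n C k)
pascal n k =
  trans (cong +_ (sym (nCk+nC[k+1]≡[n+1]C[k+1] n k)))
        (ℤP.+-comm (+ (n C k)) (+ (n C suc k)))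

vandermonde : ∀ m x j → + ((x ℕ.+ m) C j) ≡ sumTo j (λ b → + (m C (j ∸ b)) ℤ.* + (x C b))
vandermonde m zero j =
  sym (trans (sumTo-head j _ (λ i → ℤP.*-zeroʳ (+ (m C (j ∸ suc i)))))
             (ℤP.*-identityʳ (+ (m C j))))
vandermonde m (suc x) zero    = refl
vandermonde m (suc x) (suc j) = begin
    + (suc (x ℕ.+ m) C suc j)
  ≡⟨ pascal (x ℕ.+ m) j ⟩
    + ((x ℕ.+ m) C suc j) ℤ.+ + ((x ℕ.+ m) C j)
  ≡⟨ cong₂ ℤ._+_ (trans (vandermonde m x (suc j)) (sumTo-shift j _)) (vandermonde m x j) ⟩
    (first ℤ.+ sumTo j (λ b → g b ℤ.* + (x C suc b))) ℤ.+ sumTo j (λ b → g b ℤ.* + (x C b))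
  ≡⟨ ℤP.+-assoc first _ _ ⟩
    first ℤ.+ (sumTo j (λ b → g b ℤ.* + (x C suc b)) ℤ.+ sumTo j (λ b → g b ℤ.* + (x C b)))
  ≡⟨ cong (ℤ._+_ first) (sym (sumTo-+ j _ _)) ⟩
    first ℤ.+ sumTo j (λ b → g b ℤ.* + (x C suc b) ℤ.+ g b ℤ.* + (x C b))
  ≡⟨ cong (ℤ._+_ first) (sumTo-cong j _ _ (λ b →
       trans (sym (ℤP.*-distribˡ-+ (g b) _ _)) (cong (g b ℤ.*_) (sym (pascal x b))))) ⟩
    first ℤ.+ sumTo j (λ b → g b ℤ.* + (suc x C suc b))
  ≡⟨ sym (sumTo-shift j _) ⟩
    sumTo (suc j) (λ b → + (m C (suc j ∸ b)) ℤ.* + (suc x C b))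
  ∎
  where
  open ≡-Reasoning
  g : ℕ → ℤ
  g b = + (m C (j ∸ b))
  first : ℤ
  first = + (m C suc j) ℤ.* + 1

C2-double : ∀ n → (n C 2) ℕ.* 2 ≡ n ℕ.* (n ∸ 1)
C2-double zero          = refl
C2-double (suc zero)    = refl
C2-double (suc (suc n)) = begin
    (suc (suc n) C 2) ℕ.* 2
  ≡⟨ cong (ℕ._* 2) (sym (nCk+nC[k+1]≡[n+1]C[k+1] (suc n) 1)) ⟩
    ((suc n C 1) ℕ.+ (suc n C 2)) ℕ.* 2
  ≡⟨ cong (λ z → (z ℕ.+ (suc n C 2)) ℕ.* 2) (nC1≡n (suc n)) ⟩
    (suc n ℕ.+ (suc n C 2)) ℕ.* 2
  ≡⟨ ℕP.*-distribʳ-+ 2 (suc n) (suc n C 2) ⟩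
    suc n ℕ.* 2 ℕ.+ (suc n C 2) ℕ.* 2
  ≡⟨ cong (suc n ℕ.* 2 ℕ.+_) (C2-double (suc n)) ⟩
    suc n ℕ.* 2 ℕ.+ suc n ℕ.* n
  ≡⟨ regroup n ⟩
    suc (suc n) ℕ.* suc n
  ∎
  where
  open ≡-Reasoning
  regroup : ∀ n → suc n ℕ.* 2 ℕ.+ suc n ℕ.* n ≡ suc (suc n) ℕ.* suc n
  regroup = ℕRing.solve-∀

Δ : (ℕ → ℤ) → ℕ → ℤ
Δ F k = F (suc k) ℤ.- F k

Δ^ : ℕ → (ℕ → ℤ) → ℕ → ℤ
Δ^ zero    F = F
Δ^ (suc i) F = Δ^ i (Δ F)

Δ^-cong : ∀ i F G → (∀ k → F k ≡ G k) → ∀ k → Δ^ i F k ≡ Δ^ i G k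
Δ^-cong zero    F G F≡G = F≡G
Δ^-cong (suc i) F G F≡G = Δ^-cong i (Δ F) (Δ G) (λ k → cong₂ ℤ._-_ (F≡G (suc k)) (F≡G k))

Δ^-zero : ∀ i F → (∀ k → F k ≡ ℤ.0ℤ) → ∀ k → Δ^ i F k ≡ ℤ.0ℤ
Δ^-zero zero    F F≡0 = F≡0
Δ^-zero (suc i) F F≡0 = Δ^-zero i (Δ F) (λ k → cong₂ ℤ._-_ (F≡0 (suc k)) (F≡0 k))

Δ^-+ : ∀ i F G k → Δ^ i (λ x → F x ℤ.+ G x) k ≡ Δ^ i F k ℤ.+ Δ^ i G k
Δ^-+ zero    F G k = refl
Δ^-+ (suc i) F G k =
  trans (Δ^-cong i _ (λ x → Δ F x ℤ.+ Δ G x)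
                 (λ x → diff-+ (F (suc x)) (G (suc x)) (F x) (G x)) k)
        (Δ^-+ i (Δ F) (Δ G) k)
  where
  diff-+ : ∀ a b c d → (a ℤ.+ b) ℤ.- (c ℤ.+ d) ≡ (a ℤ.- c) ℤ.+ (b ℤ.- d)
  diff-+ = solve-∀

Δ^-* : ∀ i a F k → Δ^ i (λ x → a ℤ.* F x) k ≡ a ℤ.* Δ^ i F k
Δ^-* zero    a F k = refl
Δ^-* (suc i) a F k =
  trans (Δ^-cong i _ (λ x → a ℤ.* Δ F x) (λ x → diff-* a (F (suc x)) (F x)) k)
        (Δ^-* i a (Δ F) k)
  where
  diff-* : ∀ a x y → a ℤ.* x ℤ.- a ℤ.* y ≡ a ℤ.* (x ℤ.- y)
  diff-* = solve-∀

Δ^-sum : ∀ i n (G : ℕ → ℕ → ℤ) k →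
  Δ^ i (λ x → sumTo n (λ b → G b x)) k ≡ sumTo n (λ b → Δ^ i (G b) k)
Δ^-sum i zero    G k = refl
Δ^-sum i (suc n) G k =
  trans (Δ^-+ i (λ x → sumTo n (λ b → G b x)) (G (suc n)) k)
        (cong (ℤ._+ Δ^ i (G (suc n)) k) (Δ^-sum i n G k))

Δ-binomialSum : ∀ n (c : ℕ → ℤ) k →
  sumTo (suc n) (λ i → c i ℤ.* + (suc k C i)) ℤ.- sumTo (suc n) (λ i → c i ℤ.* + (k C i))
  ≡ sumTo n (λ i → c (suc i) ℤ.* + (k C i))
Δ-binomialSum n c k = begin
    sumTo (suc n) (λ i → c i ℤ.* + (suc k C i)) ℤ.- sumTo (suc n) (λ i → c i ℤ.* + (k C i))
  ≡⟨ cong₂ ℤ._-_ (sumTo-shift n _) (sumTo-shift n _) ⟩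
    (c₀ ℤ.+ sumTo n (λ i → c (suc i) ℤ.* + (suc k C suc i))) ℤ.- (c₀ ℤ.+ U)
  ≡⟨ cong (λ z → (c₀ ℤ.+ z) ℤ.- (c₀ ℤ.+ U)) (sumTo-cong n _ _ (λ i →
       trans (cong (c (suc i) ℤ.*_) (pascal k i)) (ℤP.*-distribˡ-+ (c (suc i)) _ _))) ⟩
    (c₀ ℤ.+ sumTo n (λ i → c (suc i) ℤ.* + (k C suc i) ℤ.+ c (suc i) ℤ.* + (k C i)))
      ℤ.- (c₀ ℤ.+ U)
  ≡⟨ cong (λ z → (c₀ ℤ.+ z) ℤ.- (c₀ ℤ.+ U)) (sumTo-+ n _ _) ⟩
    (c₀ ℤ.+ (U ℤ.+ S)) ℤ.- (c₀ ℤ.+ U)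
  ≡⟨ cancel c₀ U S ⟩
    S
  ∎
  where
  open ≡-Reasoning
  c₀ U S : ℤ
  c₀ = c 0 ℤ.* + 1
  U  = sumTo n (λ i → c (suc i) ℤ.* + (k C suc i))
  S  = sumTo n (λ i → c (suc i) ℤ.* + (k C i))
  cancel : ∀ a u s → (a ℤ.+ (u ℤ.+ s)) ℤ.- (a ℤ.+ u) ≡ s
  cancel = solve-∀

HasExpansion : ℕ → (ℕ → ℤ) → (ℕ → ℤ) → Set
HasExpansion n c F = ∀ k → F k ≡ sumTo n (λ i → c i ℤ.* + (k C i))

Δ-expansion : ∀ n c F → HasExpansion (suc n) c F → HasExpansion n (λ i → c (suc i)) (Δ F)
Δ-expansion n c F hF k = trans (cong₂ ℤ._-_ (hF (suc k)) (hF k)) (Δ-binomialSum n c k)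

newton-coefficient : ∀ n c F → HasExpansion n c F → ∀ i → i ℕ.≤ n → Δ^ i F 0 ≡ c i
newton-coefficient n c F hF zero _ =
  trans (hF 0) (trans (sumTo-head n _ (λ i → ℤP.*-zeroʳ (c (suc i)))) (ℤP.*-identityʳ (c 0)))
newton-coefficient (suc n) c F hF (suc i) (s≤s i≤n) =
  newton-coefficient n (λ i → c (suc i)) (Δ F) (Δ-expansion n c F hF) i i≤n

newton-vanish : ∀ n c F → HasExpansion n c F → ∀ i → n ℕ.< i → ∀ k → Δ^ i F k ≡ ℤ.0ℤ
newton-vanish zero c F hF (suc i) _ =
  Δ^-zero i (Δ F) (λ k → trans (cong₂ ℤ._-_ (hF (suc k)) (hF k)) (ℤP.+-inverseʳ (c 0 ℤ.* + 1)))
newton-vanish (suc n) c F hF (suc i) (s≤s n<i) =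
  newton-vanish n (λ i → c (suc i)) (Δ F) (Δ-expansion n c F hF) i n<i

*-pres-∣ : ∀ {a b c d} → a ℤS.∣ b → c ℤS.∣ d → (a ℤ.* c) ℤS.∣ (b ℤ.* d)
*-pres-∣ {b = b} {c = c} a∣b c∣d = ℤS.∣-trans (ℤS.*-monoˡ-∣ c a∣b) (ℤS.*-monoʳ-∣ b c∣d)

ℕ∣⇒ℤ∣ : ∀ {a b} → a ℕD.∣ b → + a ℤS.∣ + b
ℕ∣⇒ℤ∣ = ℤS.∣ᵤ⇒∣

1∣ : ∀ x → + 1 ℤS.∣ x
1∣ x = ℤS.divides x (sym (ℤP.*-identityʳ x))

^-monoˡ-∣ : ∀ {a b} e → a ℕD.∣ b → a ^ e ℕD.∣ b ^ e
^-monoˡ-∣ zero    _   = ℕD.∣-refl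
^-monoˡ-∣ (suc e) a∣b = ℕD.*-pres-∣ a∣b (^-monoˡ-∣ e a∣b)

^-monoʳ-∣ : ∀ a {e f} → e ℕ.≤ f → a ^ e ℕD.∣ a ^ f
^-monoʳ-∣ a {e} {f} e≤f =
  subst (a ^ e ℕD.∣_)
        (trans (sym (ℕP.^-distribˡ-+-* a e (f ∸ e))) (cong (a ^_) (ℕP.m+[n∸m]≡n e≤f)))
        (ℕD.m∣m*n (a ^ (f ∸ e)))

-- The integer weight w: it agrees with v except that v(s_{j,j−1}) = (j−1) − ε
-- carries the extra −ε, so v ≤ w for ε ≥ 0.
weight : ℕ → ℕ → ℕ
weight j i with i ℕ.≟ j
... | yes _ = j
... | no _ with suc i ℕ.≟ j
...   | yes _ = i
...   | no _  = 0

monWeight : Monomial → ℕ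
monWeight []             = 0
monWeight ((u , v) ∷ ps) = weight u v ℕ.+ monWeight ps

module CoefficientTable (m : ℕ) where

  F : ℕ → ℕ → ℤ
  F j k = + ((k ℕ.* m ℕ.+ 1) C j)

  T : ℕ → ℕ → ℤ
  T j i = Δ^ i (F j) 0

  ΔF : ∀ j k → Δ (F (suc j)) k ≡ sumTo j (λ b → + (m C (suc j ∸ b)) ℤ.* F b k)
  ΔF j k = begin
      F (suc j) (suc k) ℤ.- F (suc j) k
    ≡⟨ cong (λ z → + (z C suc j) ℤ.- F (suc j) k) km+1+m ⟩
      + (((k ℕ.* m ℕ.+ 1) ℕ.+ m) C suc j) ℤ.- F (suc j) k
    ≡⟨ cong (ℤ._- F (suc j) k) (vandermonde m (k ℕ.* m ℕ.+ 1) (suc j)) ⟩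
      (S ℤ.+ + (m C (j ∸ j)) ℤ.* F (suc j) k) ℤ.- F (suc j) k
    ≡⟨ cong (λ z → (S ℤ.+ + (m C z) ℤ.* F (suc j) k) ℤ.- F (suc j) k) (ℕP.n∸n≡0 j) ⟩
      (S ℤ.+ + 1 ℤ.* F (suc j) k) ℤ.- F (suc j) k
    ≡⟨ cancel S (F (suc j) k) ⟩
      S
    ∎
    where
    open ≡-Reasoning
    S : ℤ
    S = sumTo j (λ b → + (m C (suc j ∸ b)) ℤ.* F b k)
    km+1+m : suc k ℕ.* m ℕ.+ 1 ≡ (k ℕ.* m ℕ.+ 1) ℕ.+ m
    km+1+m = trans (ℕP.+-assoc m (k ℕ.* m) 1) (ℕP.+-comm m (k ℕ.* m ℕ.+ 1))
    cancel : ∀ s x → (s ℤ.+ + 1 ℤ.* x) ℤ.- x ≡ s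
    cancel = solve-∀

  T-rec : ∀ j i → T (suc j) (suc i) ≡ sumTo j (λ b → + (m C (suc j ∸ b)) ℤ.* T b i)
  T-rec j i =
    trans (Δ^-cong i _ _ (ΔF j) 0)
      (trans (Δ^-sum i j (λ b x → + (m C (suc j ∸ b)) ℤ.* F b x) 0)
             (sumTo-cong j _ _ (λ b → Δ^-* i (+ (m C (suc j ∸ b))) (F b) 0)))

  module _ (s : ℕ → ℕ → ℤ) (hs : IsSCoeffs m s) where

    s≡T : ∀ j i → i ℕ.≤ j → s j i ≡ T j i
    s≡T j i i≤j = sym (newton-coefficient j (s j) (F j) (hs j) i i≤j)

    -- F_b is a polynomial of degree b, so T_{b,i} = 0 for b < i.
    T-vanish : ∀ b i → b ℕ.< i → T b i ≡ ℤ.0ℤ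
    T-vanish b i b<i = newton-vanish b (s b) (F b) (hs b) i b<i 0

    sumTo-lastTerm : ∀ j i (a : ℕ → ℤ) → j ℕ.≤ i →
      sumTo j (λ b → a b ℤ.* T b i) ≡ a j ℤ.* T j i
    sumTo-lastTerm j i a j≤i = sumTo-last j _ (λ b b<j →
      trans (cong (a b ℤ.*_) (T-vanish b i (ℕP.<-≤-trans b<j j≤i))) (ℤP.*-zeroʳ (a b)))

    T-diag : ∀ j → T j j ≡ + (m ^ j)
    T-diag zero    = refl
    T-diag (suc j) = begin
        T (suc j) (suc j)
      ≡⟨ T-rec j j ⟩
        sumTo j (λ b → + (m C (suc j ∸ b)) ℤ.* T b j)
      ≡⟨ sumTo-lastTerm j j (λ b → + (m C (suc j ∸ b))) ℕP.≤-refl ⟩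
        + (m C (1 ℕ.+ j ∸ j)) ℤ.* T j j
      ≡⟨ cong₂ (λ a t → + (m C a) ℤ.* t) (ℕP.m+n∸n≡m 1 j) (T-diag j) ⟩
        + (m C 1) ℤ.* + (m ^ j)
      ≡⟨ cong (λ z → + z ℤ.* + (m ^ j)) (nC1≡n m) ⟩
        + m ℤ.* + (m ^ j)
      ≡⟨ ℤP.pos-* m (m ^ j) ⟨
        + (m ^ suc j)
      ∎
      where open ≡-Reasoning

    T-subdiag-rec : ∀ j →
      T (suc (suc j)) (suc j) ≡ + (m C 2) ℤ.* + (m ^ j) ℤ.+ + m ℤ.* T (suc j) j
    T-subdiag-rec j = begin
        T (suc (suc j)) (suc j)
      ≡⟨ T-rec (suc j) j ⟩
        sumTo j (λ b → + (m C (2 ℕ.+ j ∸ b)) ℤ.* T b j) ℤ.+ + (m C (1 ℕ.+ j ∸ j)) ℤ.* T (suc j) j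
      ≡⟨ cong (ℤ._+ + (m C (1 ℕ.+ j ∸ j)) ℤ.* T (suc j) j) (sumTo-lastTerm j j (λ b → + (m C (2 ℕ.+ j ∸ b))) ℕP.≤-refl) ⟩
        + (m C (2 ℕ.+ j ∸ j)) ℤ.* T j j ℤ.+ + (m C (1 ℕ.+ j ∸ j)) ℤ.* T (suc j) j
      ≡⟨ cong₂ (λ a b → + (m C a) ℤ.* T j j ℤ.+ + (m C b) ℤ.* T (suc j) j)
               (ℕP.m+n∸n≡m 2 j) (ℕP.m+n∸n≡m 1 j) ⟩
        + (m C 2) ℤ.* T j j ℤ.+ + (m C 1) ℤ.* T (suc j) j
      ≡⟨ cong₂ (λ t c → + (m C 2) ℤ.* t ℤ.+ + c ℤ.* T (suc j) j) (T-diag j) (nC1≡n m) ⟩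
        + (m C 2) ℤ.* + (m ^ j) ℤ.+ + m ℤ.* T (suc j) j
      ∎
      where open ≡-Reasoning

    module _ (d : ℕ) (d∣m : d ℕD.∣ m) (d∣m₂ : d ℕD.∣ m C 2) where

      T-subdiag-∣ : ∀ j → + (d ^ j) ℤS.∣ T (suc j) j
      T-subdiag-∣ zero    = 1∣ (T 1 0)
      T-subdiag-∣ (suc j) =
        subst₂ ℤS._∣_ (sym (ℤP.pos-* d (d ^ j))) (sym (T-subdiag-rec j))
          (ℤS.∣m∣n⇒∣m+n (*-pres-∣ (ℕ∣⇒ℤ∣ d∣m₂) (ℕ∣⇒ℤ∣ (^-monoˡ-∣ j d∣m)))
                        (*-pres-∣ (ℕ∣⇒ℤ∣ d∣m) (T-subdiag-∣ j)))

      factor-∣ : ∀ u v → + (d ^ weight u v) ℤS.∣ s u v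
      factor-∣ u v with v ℕ.≟ u
      ... | yes refl =
        subst (+ (d ^ v) ℤS.∣_) (sym (trans (s≡T v v ℕP.≤-refl) (T-diag v)))
              (ℕ∣⇒ℤ∣ (^-monoˡ-∣ v d∣m))
      ... | no _ with suc v ℕ.≟ u
      ...   | yes refl = subst (+ (d ^ v) ℤS.∣_) (sym (s≡T (suc v) v (ℕP.n≤1+n v))) (T-subdiag-∣ v)
      ...   | no _     = 1∣ (s u v)

      monomial-∣ : ∀ p → + (d ^ monWeight p) ℤS.∣ evalMon s p
      monomial-∣ []             = 1∣ (+ 1)
      monomial-∣ ((u , v) ∷ ps) =
        subst (ℤS._∣ evalMon s ((u , v) ∷ ps))
              (trans (sym (ℤP.pos-* (d ^ weight u v) (d ^ monWeight ps)))
                     (cong +_ (sym (ℕP.^-distribˡ-+-* d (weight u v) (monWeight ps)))))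
              (*-pres-∣ (factor-∣ u v) (monomial-∣ ps))

base : ℕ → ℕ
base m with 2 ∣? m
... | yes _ = m ℕ./ 2
... | no _  = m

base∣m : ∀ m → base m ℕD.∣ m
base∣m m with 2 ∣? m
... | yes 2∣m = ℕD.m/n∣m 2∣m
... | no _    = ℕD.∣-refl

-- m ∣ 2·C(m,2) handles odd m; for even m, m/2 ∣ C(m,2).
base∣C2 : ∀ m → base m ℕD.∣ m C 2
base∣C2 m with 2 ∣? m
... | yes 2∣m = ℕD.m∣n*o⇒m/n∣o 2∣m m∣C2*2
  where
  m∣C2*2 : m ℕD.∣ (m C 2) ℕ.* 2
  m∣C2*2 = subst (m ℕD.∣_) (sym (C2-double m)) (ℕD.m∣m*n (m ∸ 1))
... | no 2∤m with euclidsLemma m (m ∸ 1) prime[2]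
                    (subst (2 ℕD.∣_) (C2-double m) (ℕD.n∣m*n (m C 2)))
...   | inj₁ 2∣m   = ⊥-elim (2∤m 2∣m)
...   | inj₂ 2∣m-1 =
  ℕD.*-cancelʳ-∣ 2 (subst (m ℕ.* 2 ℕD.∣_) (sym (C2-double m)) (ℕD.*-monoʳ-∣ m 2∣m-1))

*-^ : ∀ a b e → (a ℕ.* b) ^ e ≡ a ^ e ℕ.* b ^ e
*-^ a b zero    = refl
*-^ a b (suc e) =
  trans (cong ((a ℕ.* b) ℕ.*_) (*-^ a b e)) (interchange a b (a ^ e) (b ^ e))
  where
  interchange : ∀ a b x y → (a ℕ.* b) ℕ.* (x ℕ.* y) ≡ (a ℕ.* x) ℕ.* (b ℕ.* y)
  interchange = ℕRing.solve-∀

divisor≡base^ : ∀ m e → divisor m e ≡ base m ^ e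
divisor≡base^ m e with 2 ∣? m
... | yes 2∣m = begin
    (m ^ e) ℕ./ (2 ^ e)
  ≡⟨ cong (λ z → (z ^ e) ℕ./ (2 ^ e)) (ℕD.m∣n⇒n≡quotient*m 2∣m) ⟩
    ((q ℕ.* 2) ^ e) ℕ./ (2 ^ e)
  ≡⟨ cong (ℕ._/ (2 ^ e)) (*-^ q 2 e) ⟩
    (q ^ e ℕ.* 2 ^ e) ℕ./ (2 ^ e)
  ≡⟨ m*n/n≡m (q ^ e) (2 ^ e) ⟩
    q ^ e
  ≡⟨ cong (_^ e) (sym (ℕD.n/m≡quotient 2∣m)) ⟩
    (m ℕ./ 2) ^ e
  ∎
  where
  open ≡-Reasoning
  instance _ = ℕP.m^n≢0 2 e
  q : ℕ
  q = ℕD.quotient 2∣m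
... | no _ = n/1≡n (m ^ e)

toℚᵘ-/1 : ∀ i → ℚ.toℚᵘ (i / 1) ℚᵘ.≃ mkℚᵘ i 0
toℚᵘ-/1 i = ℚP.toℚᵘ-fromℚᵘ (mkℚᵘ i 0)

/1-homo-+ : ∀ i j → i / 1 ℚ.+ j / 1 ≡ (i ℤ.+ j) / 1
/1-homo-+ i j = ℚP.toℚᵘ-injective
  (ℚᵘP.≃-trans (ℚP.toℚᵘ-homo-+ (i / 1) (j / 1))
  (ℚᵘP.≃-trans (ℚᵘP.+-cong (toℚᵘ-/1 i) (toℚᵘ-/1 j))
  (ℚᵘP.≃-trans (*≡* (add-over-1 i j)) (ℚᵘP.≃-sym (toℚᵘ-/1 (i ℤ.+ j))))))
  where
  add-over-1 : ∀ i j → (i ℤ.* + 1 ℤ.+ j ℤ.* + 1) ℤ.* + 1 ≡ (i ℤ.+ j) ℤ.* (+ 1 ℤ.* + 1)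
  add-over-1 = solve-∀

/1-cancel-< : ∀ i j → i / 1 ℚ.< j / 1 → i ℤ.< j
/1-cancel-< i j i<j =
  subst₂ ℤ._<_ (ℤP.*-identityʳ i) (ℤP.*-identityʳ j)
    (ℚᵘP.drop-*<* (ℚᵘP.<-respˡ-≃ (toℚᵘ-/1 i) (ℚᵘP.<-respʳ-≃ (toℚᵘ-/1 j) (ℚP.toℚᵘ-mono-< i<j))))

module _ (ε : ℚ) (0≤ε : ℚ.0ℚ ℚ.≤ ε) where

  vFactor≤weight : ∀ j i → vFactor ε j i ℚ.≤ ℕtoℚ (weight j i)
  vFactor≤weight j i with i ℕ.≟ j
  ... | yes _ = ℚP.≤-refl
  ... | no _ with suc i ℕ.≟ j
  ...   | yes _ = subst (ℕtoℚ i ℚ.- ε ℚ.≤_) (ℚP.+-identityʳ (ℕtoℚ i))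
                        (ℚP.+-monoʳ-≤ (ℕtoℚ i) (ℚP.neg-antimono-≤ 0≤ε))
  ...   | no _  = ℚP.≤-refl

  vMon≤monWeight : ∀ p → vMon ε p ℚ.≤ ℕtoℚ (monWeight p)
  vMon≤monWeight []             = ℚP.≤-refl
  vMon≤monWeight ((u , v) ∷ ps) =
    subst (vMon ε ((u , v) ∷ ps) ℚ.≤_) (/1-homo-+ (+ weight u v) (+ monWeight ps))
          (ℚP.+-mono-≤ (vFactor≤weight u v) (vMon≤monWeight ps))

exponent≤ : ∀ ℓ n → -[1+ 0 ] ℤ.≤ ℓ → ℓ ℤ.< + n → ∣ ℓ ℤ.+ + 1 ∣ ℕ.≤ n
exponent≤ (+ k)          n _            (ℤ.+<+ k<n) = subst (ℕ._≤ n) (ℕP.+-comm 1 k) k<n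
exponent≤ -[1+ 0 ]       n _            _           = z≤n
exponent≤ -[1+ suc k ]   n (ℤ.-≤- ())   _

-- With d = base m: base^{ℓ+1} ∣ base^{w(p)} ∣ p, since ℓ < v(p) ≤ w(p).
mainTheorem2 : (m : ℕ) → 2 ℕ.≤ m → (s : ℕ → ℕ → ℤ) → IsSCoeffs m s →
    (ε : ℚ) → ℚ.0ℚ ℚ.< ε →
    (p : Monomial) → WellIndexed p →
    (ℓ : ℤ) → -[1+ 0 ] ℤ.≤ ℓ →
    ℓ / 1 ℚ.< vMon ε p →
    (+ divisor m ∣ ℓ ℤ.+ + 1 ∣) ℤD.∣ evalMon s p
mainTheorem2 m _ s hs ε 0<ε p _ ℓ -1≤ℓ ℓ<vp =
  subst (λ z → + z ℤD.∣ evalMon s p) (sym (divisor≡base^ m e))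
    (ℤS.∣⇒∣ᵤ (ℤS.∣-trans (ℕ∣⇒ℤ∣ (^-monoʳ-∣ (base m) e≤w)) base^w∣p))
  where
  open CoefficientTable m
  e : ℕ
  e = ∣ ℓ ℤ.+ + 1 ∣
  base^w∣p : + (base m ^ monWeight p) ℤS.∣ evalMon s p
  base^w∣p = monomial-∣ s hs (base m) (base∣m m) (base∣C2 m) p
  e≤w : e ℕ.≤ monWeight p
  e≤w = exponent≤ ℓ (monWeight p) -1≤ℓ
          (/1-cancel-< ℓ (+ monWeight p)
            (ℚP.<-≤-trans ℓ<vp (vMon≤monWeight ε (ℚP.<⇒≤ 0<ε) p)))
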